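{- $\mathsf{HS}_{\mathsf{ct}}\not\geq\mathsf{HS}_{\mathsf{st}}$: there exists an $\mathsf{HS}$ formula $\psi$ such that no $\mathsf{HS}$ formula $\psi'$ satisfies $K\models_{\mathsf{ct}}\psi'\iff K\models_{\mathsf{st}}\psi$ for all finite Kripke structures $K$.
   Context: A Kripke structure is $K=(\mathcal{AP},S,\delta,\mu,s_0)$ ($\mathcal{AP}$ finite, left-total $\delta\subseteq S\times S$, $\mu:S\to2^{\mathcal{AP}}$, initial $s_0$); finite if $S$ finite. Traces are non-empty finite sequences of states following $\delta$, initial if they start at $s_0$; $\mathrm{lst}(\rho)$ is the last state. $\mathsf{HS}$: $\psi::=p\mid\neg\psi\mid\psi\wedge\psi\mid\langle B\rangle\psi\mid\langle E\rangle\psi\mid\langle\overline{B}\rangle\psi\mid\langle\overline{E}\rangle\psi$ (other Halpern–Shoham modalities, e.g. $\langle A\rangle$, are abbreviations). State-based semantics on traces: $\rho\models p$ iff $p$ labels every state of $\rho$; $\langle B\rangle$/$\langle E\rangle$: some proper non-empty prefix/suffix of $\rho$ satisfies the argument; $\langle\overline{B}\rangle$/$\langle\overline{E}\rangle$: some trace having $\rho$ as proper prefix/suffix satisfies it; $K\models_{\mathsf{st}}\psi$ iff all initial traces satisfy $\psi$. $C(K)$: states are initial traces of $K$, transitions $(\rho,\rho s)$ for $(\mathrm{lst}(\rho),s)\in\delta$, labels $\mu(\mathrm{lst}(\rho))$, initial state $s_0$; $K\models_{\mathsf{ct}}\psi$ iff $C(K)\models_{\mathsf{st}}\psi$. -}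

module Defs where

open import Data.Nat using (ℕ)
open import Data.Fin using (Fin)
open import Data.Bool using (Bool; true; T)
open import Data.List using (List; []; _∷_; _++_; [_])
open import Data.List.Relation.Unary.All using (All)
open import Data.List.Relation.Unary.Linked using (Linked; []; [-]; _∷_)
open import Data.Product using (Σ; ∃; ∃-syntax; _×_; _,_; proj₁; proj₂)
open import Relation.Binary.PropositionalEquality using (_≡_; refl)
open import Relation.Nullary using (¬_)

data HS (AP : Set) : Set where
  prop : AP → HS AP
  ¬ₕ_  : HS AP → HS AP
  _∧ₕ_ : HS AP → HS AP → HS AP
  ⟨B⟩ ⟨E⟩ ⟨B̄⟩ ⟨Ē⟩ : HS AP → HS AP

record Kripke (AP : Set) : Set₁ where
  field
    S     : Set
    δ     : S → S → Set
    total : ∀ s → ∃[ t ] δ s t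
    μ     : S → AP → Bool
    s₀    : S

module Semantics {AP : Set} (K : Kripke AP) where
  open Kripke K

  -- A trace is a non-empty list  s ∷ ts  with  Linked δ (s ∷ ts).
  -- sat ψ s ts :  the trace  s ∷ ts  satisfies ψ (state-based semantics)
  sat : HS AP → S → List S → Set
  sat (prop p)  s ts = All (λ x → μ x p ≡ true) (s ∷ ts)
  sat (¬ₕ ψ)    s ts = ¬ sat ψ s ts
  sat (ψ ∧ₕ φ)  s ts = sat ψ s ts × sat φ s ts
  sat (⟨B⟩ ψ)   s ts = ∃[ us ] ∃[ v ] ∃[ vs ] (ts ≡ us ++ (v ∷ vs)) × sat ψ s us
  sat (⟨E⟩ ψ)   s ts = ∃[ pre ] ∃[ v ] ∃[ vs ] (ts ≡ pre ++ (v ∷ vs)) × sat ψ v vs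
  sat (⟨B̄⟩ ψ)  s ts = ∃[ v ] ∃[ vs ] Linked δ (s ∷ (ts ++ (v ∷ vs))) × sat ψ s (ts ++ (v ∷ vs))
  sat (⟨Ē⟩ ψ)  s ts = ∃[ u ] ∃[ us ] Linked δ (u ∷ (us ++ (s ∷ ts))) × sat ψ u (us ++ (s ∷ ts))

  _⊨st_ : HS AP → Set
  _⊨st_ ψ = ∀ ts → Linked δ (s₀ ∷ ts) → sat ψ s₀ ts

record FinKripke (AP : Set) : Set where
  field
    n     : ℕ
    δ     : Fin n → Fin n → Bool
    total : ∀ s → ∃[ t ] T (δ s t)
    μ     : Fin n → AP → Bool
    s₀    : Fin n

lastOf : {A : Set} → A → List A → A
lastOf s []       = s
lastOf s (t ∷ ts) = lastOf t ts

linked-snoc : {A : Set} {R : A → A → Set} (s : A) (ts : List A) (x : A) →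
              Linked R (s ∷ ts) → R (lastOf s ts) x → Linked R (s ∷ (ts ++ [ x ]))
linked-snoc s []       x l     r = r ∷ [-]
linked-snoc s (t ∷ ts) x (h ∷ l) r = h ∷ linked-snoc t ts x l r

toKripke : {AP : Set} → FinKripke AP → Kripke AP
toKripke K = record { S = Fin n ; δ = λ s t → T (δ s t) ; total = total ; μ = μ ; s₀ = s₀ }
  where open FinKripke K

-- the computation tree C(K): states are the initial traces  s₀ ∷ ts  of K
C : {AP : Set} → FinKripke AP → Kripke AP
C {AP} K = record
  { S     = St
  ; δ     = Δ
  ; total = tot
  ; μ     = λ ρ → μ (lastOf s₀ (proj₁ ρ))
  ; s₀    = ([] , [-])
  }
  where
    open FinKripke K
    R : Fin n → Fin n → Set
    R s t = T (δ s t)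
    St : Set
    St = Σ (List (Fin n)) (λ ts → Linked R (s₀ ∷ ts))
    Δ : St → St → Set
    Δ ρ ρ′ = ∃[ s ] (proj₁ ρ′ ≡ proj₁ ρ ++ [ s ]) × R (lastOf s₀ (proj₁ ρ)) s
    tot : ∀ ρ → ∃[ ρ′ ] Δ ρ ρ′
    tot (ts , l) with total (lastOf s₀ ts)
    ... | (s , r) = ((ts ++ [ s ]) , linked-snoc s₀ ts s l r) , s , refl , r

_⊨st_ : {AP : Set} → FinKripke AP → HS AP → Set
K ⊨st ψ = Semantics._⊨st_ (toKripke K) ψ

_⊨ct_ : {AP : Set} → FinKripke AP → HS AP → Set
K ⊨ct ψ = Semantics._⊨st_ (C K) ψ

-- An HS formula evaluated on the computation tree only sees the traces of K that start in the
-- initial state, whereas the state-based semantics also quantifies, through ⟨Ē⟩, over traces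
-- that enter the initial trace from states unreachable from s₀.  Take two states, s₀ labelled p
-- and u unlabelled, where s₀ loops on itself.  If u has an edge into s₀, every initial trace
-- satisfies ⟨Ē⟩¬p; if u only loops on itself, the trace s₀ does not.  Both structures have the
-- same computation tree, the sequences s₀ⁿ, and HS cannot tell apart structures related by a
-- bisimulation that matches transitions between all related states.
module Submission where

open import Defs
open import Data.Bool using (Bool; true; false; T)
open import Data.Fin using (Fin; zero; suc)
open import Data.List using (List; []; _∷_; _++_; [_])
open import Data.List.Relation.Binary.Pointwise using (Pointwise; []; _∷_; ++⁺; symmetric)
open import Data.List.Relation.Unary.All as All using (All; []; _∷_)
open import Data.List.Relation.Unary.Linked using (Linked; []; [-]; _∷_)
open import Data.Product using (∃-syntax; _×_; _,_; proj₁)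
open import Data.Unit using (tt)
open import Function.Base using (id)
open import Function.Bundles using (_⇔_; Equivalence)
open import Relation.Binary.PropositionalEquality using (_≡_; refl; sym; trans; cong-app)
open import Relation.Nullary using (¬_)

module _ {A B : Set} {R : A → B → Set} where

  Pointwise-++⁻ : ∀ xs {ys zs} → Pointwise R (xs ++ ys) zs →
                  ∃[ xs′ ] ∃[ ys′ ] (zs ≡ xs′ ++ ys′) × Pointwise R xs xs′ × Pointwise R ys ys′
  Pointwise-++⁻ []       rs       = [] , _ , refl , [] , rs
  Pointwise-++⁻ (x ∷ xs) (r ∷ rs) with Pointwise-++⁻ xs rs
  ... | xs′ , ys′ , refl , rs₁ , rs₂ = _ ∷ xs′ , ys′ , refl , r ∷ rs₁ , rs₂

  Pointwise-total : (∀ x → ∃[ y ] R x y) → ∀ xs → ∃[ ys ] Pointwise R xs ys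
  Pointwise-total total []       = [] , []
  Pointwise-total total (x ∷ xs) with total x | Pointwise-total total xs
  ... | y , r | ys , rs = y ∷ ys , r ∷ rs

  Linked-Pointwise : {D : A → A → Set} {D′ : B → B → Set} →
                     (∀ {x x′ y y′} → R x x′ → R y y′ → D x y → D′ x′ y′) →
                     ∀ {xs ys} → Pointwise R xs ys → Linked D xs → Linked D′ ys
  Linked-Pointwise f []                []      = []
  Linked-Pointwise f (r ∷ [])          [-]     = [-]
  Linked-Pointwise f (r ∷ rs@(r′ ∷ _)) (d ∷ l) = f r r′ d ∷ Linked-Pointwise f rs l

-- Unlike an ordinary bisimulation, transitions must be matched between ALL related pairs of
-- states: ⟨Ē⟩ and ⟨B̄⟩ extend a trace by arbitrary states, not only by successors of matched ones.
record TotalBisimulation {AP : Set} (K K′ : Kripke AP) : Set₁ where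
  private
    module K  = Kripke K
    module K′ = Kripke K′
  field
    _∼_         : K.S → K′.S → Set
    left-total  : ∀ x → ∃[ x′ ] x ∼ x′
    right-total : ∀ x′ → ∃[ x ] x ∼ x′
    δ-preserved : ∀ {x x′ y y′} → x ∼ x′ → y ∼ y′ → K.δ x y → K′.δ x′ y′
    δ-reflected : ∀ {x x′ y y′} → x ∼ x′ → y ∼ y′ → K′.δ x′ y′ → K.δ x y
    μ-preserved : ∀ {x x′} → x ∼ x′ → K.μ x ≡ K′.μ x′

converse : ∀ {AP} {K K′ : Kripke AP} → TotalBisimulation K K′ → TotalBisimulation K′ K
converse B = record
  { _∼_         = λ x′ x → x ∼ x′
  ; left-total  = right-total
  ; right-total = left-total
  ; δ-preserved = δ-reflected
  ; δ-reflected = δ-preserved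
  ; μ-preserved = λ r → sym (μ-preserved r)
  }
  where open TotalBisimulation B

module _ {AP : Set} where
  open TotalBisimulation
  open Semantics using (sat)

  labels-preserved : {K K′ : Kripke AP} (B : TotalBisimulation K K′) (p : AP) → ∀ {xs ys} →
                     Pointwise (_∼_ B) xs ys →
                     All (λ x → Kripke.μ K x p ≡ true) xs → All (λ y → Kripke.μ K′ y p ≡ true) ys
  labels-preserved B p []       []       = []
  labels-preserved B p (r ∷ rs) (l ∷ ls) =
    trans (sym (cong-app (μ-preserved B r) p)) l ∷ labels-preserved B p rs ls

  sat-preserved : {K K′ : Kripke AP} (B : TotalBisimulation K K′) (ψ : HS AP) →
                  ∀ {s ts s′ ts′} → Pointwise (_∼_ B) (s ∷ ts) (s′ ∷ ts′) →
                  sat K ψ s ts → sat K′ ψ s′ ts′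
  sat-preserved B (prop p) rs h = labels-preserved B p rs h
  sat-preserved B (¬ₕ ψ)   rs h = λ h′ → h (sat-preserved (converse B) ψ (symmetric id rs) h′)
  sat-preserved B (ψ ∧ₕ φ) rs (h₁ , h₂) = sat-preserved B ψ rs h₁ , sat-preserved B φ rs h₂
  sat-preserved B (⟨B⟩ ψ) (r ∷ rs) (us , v , vs , refl , h) with Pointwise-++⁻ us rs
  ... | us′ , v′ ∷ vs′ , eq , rs₁ , _ ∷ _ = us′ , v′ , vs′ , eq , sat-preserved B ψ (r ∷ rs₁) h
  sat-preserved B (⟨E⟩ ψ) (_ ∷ rs) (us , v , vs , refl , h) with Pointwise-++⁻ us rs
  ... | us′ , v′ ∷ vs′ , eq , _ , rs₂ = us′ , v′ , vs′ , eq , sat-preserved B ψ rs₂ h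
  sat-preserved B (⟨B̄⟩ ψ) (r ∷ rs) (v , vs , l , h) with Pointwise-total (left-total B) (v ∷ vs)
  ... | v′ ∷ vs′ , rs′ =
    v′ , vs′ , Linked-Pointwise (δ-preserved B) extended l , sat-preserved B ψ extended h
    where extended = r ∷ ++⁺ rs rs′
  sat-preserved B (⟨Ē⟩ ψ) rs (u , us , l , h) with Pointwise-total (left-total B) (u ∷ us)
  ... | u′ ∷ us′ , r ∷ rs′ =
    u′ , us′ , Linked-Pointwise (δ-preserved B) extended l , sat-preserved B ψ extended h
    where extended = r ∷ ++⁺ rs′ rs

  ⊨st-preserved : {K K′ : Kripke AP} (B : TotalBisimulation K K′) →
                  _∼_ B (Kripke.s₀ K) (Kripke.s₀ K′) →
                  ∀ ψ → Semantics._⊨st_ K ψ → Semantics._⊨st_ K′ ψ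
  ⊨st-preserved B r₀ ψ h ts′ l′ with Pointwise-total (right-total B) ts′
  ... | ts , rs =
    sat-preserved B ψ (symmetric id related) (h ts (Linked-Pointwise (δ-reflected B) related l′))
    where related = r₀ ∷ rs

lastOf-constant : {A : Set} {s : A} {ts : List A} → All (_≡ s) ts → lastOf s ts ≡ s
lastOf-constant []          = refl
lastOf-constant (refl ∷ es) = lastOf-constant es

module _ {A : Set} {R : A → A → Set} {s : A} where

  Linked-stays : (∀ {t} → R s t → t ≡ s) → ∀ ts → Linked R (s ∷ ts) → All (_≡ s) ts
  Linked-stays stays []       _       = []
  Linked-stays stays (t ∷ ts) (r ∷ l) with stays r
  ... | refl = refl ∷ Linked-stays stays ts l

  Linked-stays-before : (∀ {t} → R t s → t ≡ s) →
                        ∀ u us → Linked R (u ∷ us ++ [ s ]) → All (_≡ s) (u ∷ us ++ [ s ])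
  Linked-stays-before stays u []       (r ∷ _) = stays r ∷ refl ∷ []
  Linked-stays-before stays u (w ∷ us) (r ∷ l) with Linked-stays-before stays w us l
  ... | refl ∷ es = stays r ∷ refl ∷ es

  Linked-loop : R s s → ∀ {ts} → All (_≡ s) ts → Linked R (s ∷ ts)
  Linked-loop loop []          = [-]
  Linked-loop loop (refl ∷ es) = loop ∷ Linked-loop loop es

labelling : Fin 2 → Fin 1 → Bool
labelling zero    _ = true
labelling (suc _) _ = false

into-zero : Fin 2 → Fin 2 → Bool
into-zero _ zero    = true
into-zero _ (suc _) = false

self-loops : Fin 2 → Fin 2 → Bool
self-loops zero    zero    = true
self-loops zero    (suc _) = false
self-loops (suc _) zero    = false
self-loops (suc _) (suc _) = true

entered : FinKripke (Fin 1)
entered = record { n = 2 ; δ = into-zero ; total = λ _ → zero , tt ; μ = labelling ; s₀ = zero }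

isolated : FinKripke (Fin 1)
isolated = record { n = 2 ; δ = self-loops ; total = total ; μ = labelling ; s₀ = zero }
  where
  total : ∀ s → ∃[ t ] T (self-loops s t)
  total zero    = zero , tt
  total (suc _) = suc zero , tt

⟨Ē⟩¬p : HS (Fin 1)
⟨Ē⟩¬p = ⟨Ē⟩ (¬ₕ prop zero)

into-zero-from-zero : ∀ {t} → T (into-zero zero t) → t ≡ zero
into-zero-from-zero {zero} _ = refl

self-loops-from-zero : ∀ {t} → T (self-loops zero t) → t ≡ zero
self-loops-from-zero {zero} _ = refl

self-loops-into-zero : ∀ {t} → T (self-loops t zero) → t ≡ zero
self-loops-into-zero {zero} _ = refl

computation-trees-bisimilar : TotalBisimulation (C entered) (C isolated)
computation-trees-bisimilar = record
  { _∼_         = λ ρ ρ′ → proj₁ ρ ≡ proj₁ ρ′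
  ; left-total  = λ (ts , l) → (ts , retrace self-loops into-zero-from-zero tt ts l) , refl
  ; right-total = λ (ts , l) → (ts , retrace into-zero self-loops-from-zero tt ts l) , refl
  ; δ-preserved = λ { {_ , l} refl refl (t , eq , r) →
                      t , eq , step self-loops into-zero-from-zero tt l r }
  ; δ-reflected = λ { {_} {_ , l} refl refl (t , eq , r) →
                      t , eq , step into-zero self-loops-from-zero tt l r }
  ; μ-preserved = λ { refl → refl }
  }
  where
  Edge : (Fin 2 → Fin 2 → Bool) → Fin 2 → Fin 2 → Set
  Edge δ a b = T (δ a b)

  module _ {δ : Fin 2 → Fin 2 → Bool} (δ′ : Fin 2 → Fin 2 → Bool)
           (stays : ∀ {t} → T (δ zero t) → t ≡ zero) (loop : T (δ′ zero zero)) where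

    retrace : ∀ ts → Linked (Edge δ) (zero ∷ ts) → Linked (Edge δ′) (zero ∷ ts)
    retrace ts l = Linked-loop loop (Linked-stays stays ts l)

    step : ∀ {ts} → Linked (Edge δ) (zero ∷ ts) →
           ∀ {t} → T (δ (lastOf zero ts) t) → T (δ′ (lastOf zero ts) t)
    step {ts} l = from-zero (lastOf-constant (Linked-stays stays ts l))
      where
      from-zero : ∀ {a t} → a ≡ zero → T (δ a t) → T (δ′ a t)
      from-zero refl r with stays r
      ... | refl = loop

entered-⊨⟨Ē⟩¬p : entered ⊨st ⟨Ē⟩¬p
entered-⊨⟨Ē⟩¬p ts l = suc zero , [] , tt ∷ l , λ { (() ∷ _) }

isolated-⊭⟨Ē⟩¬p : ¬ (isolated ⊨st ⟨Ē⟩¬p)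
isolated-⊭⟨Ē⟩¬p h with h [] [-]
... | u , us , l , ¬p = ¬p (All.map labelled (Linked-stays-before self-loops-into-zero u us l))
  where
  labelled : ∀ {x} → x ≡ zero → labelling x zero ≡ true
  labelled refl = refl

proposition32 : ∃[ a ] ∃[ ψ ] ∀ (ψ′ : HS (Fin a)) →
    ¬ (∀ (K : FinKripke (Fin a)) → (K ⊨ct ψ′) ⇔ (K ⊨st ψ))
proposition32 = 1 , ⟨Ē⟩¬p , λ ψ′ agrees →
  isolated-⊭⟨Ē⟩¬p (Equivalence.to (agrees isolated)
    (⊨st-preserved computation-trees-bisimilar refl ψ′
      (Equivalence.from (agrees entered) entered-⊨⟨Ē⟩¬p)))
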